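{- For every integer $k\ge 1$, $$\sum_{n\ge 0}a(n,2k,t)\,x^n=\frac{(1+x)\Phi_k(x,t)-x^2\bigl(1+(1-t)x\bigr)\Phi_{k-1}(x,t)}{\Lambda_k(x,t)-x^2\Lambda_{k-1}(x,t)}$$ as formal power series in $x$ (with coefficients polynomials in $t$).
   Context: Up-step $U:(i,j)\to(i+1,j+1)$, down-step $D:(i,j)\to(i+1,j-1)$. For integers $n,k\ge 0$, $A_{n,k}$ is the set of lattice paths of length $n$ consisting of $U$ and $D$ steps that start at $(0,0)$, end at height $0$ or $-1$, and stay in the strip $-\lfloor (k+1)/2\rfloor\le y\le \lfloor k/2\rfloor$. A peak of a path is a vertex preceded by a $U$ and followed by a $D$; a valley is a vertex preceded by a $D$ and followed by a $U$; the height of a vertex is its $y$-coordinate. The extremal points of a path $v$ are its peaks of height $\ge 1$ and its valleys of height $\le -2$; $e(v)$ is their number. Define $a(n,k,t)=\sum_{v\in A_{n,k}}t^{e(v)}$. Fibonacci polynomials: $F_0(x,s)=0$, $F_1(x,s)=1$, $F_n=xF_{n-1}+sF_{n-2}$. Lucas polynomials: $L_0(x,s)=2$, $L_1(x,s)=x$, $L_n=xL_{n-1}+sL_{n-2}$. Set $\Phi_n(x,t)=F_n(1+(1-t)x^2,-x^2)$ and $\Lambda_n(x,t)=L_n(1+(1-t)x^2,-x^2)$. -}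

module Defs where

open import Data.Bool using (Bool; true; false; _∧_; if_then_else_)
open import Data.Nat as ℕ using (ℕ; zero; suc; _∸_)
open import Data.Nat.DivMod using (_/_)
open import Data.Integer as ℤ using (ℤ; +_; -_; _≤ᵇ_)
open import Data.List using (List; []; _∷_; map; _++_; length; filterᵇ)

data Step : Set where
  U D : Step

paths : ℕ → List (List Step)
paths zero    = [] ∷ []
paths (suc n) = map (U ∷_) (paths n) ++ map (D ∷_) (paths n)

move : Step → ℤ → ℤ
move U h = h ℤ.+ ℤ.+ 1
move D h = h ℤ.- ℤ.+ 1

heights : ℤ → List Step → List ℤ
heights h []      = h ∷ []
heights h (s ∷ v) = h ∷ heights (move s h) v

endHeight : ℤ → List Step → ℤ
endHeight h []      = h
endHeight h (s ∷ v) = endHeight (move s h) v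

allᵇ : (ℤ → Bool) → List ℤ → Bool
allᵇ p []       = true
allᵇ p (x ∷ xs) = p x ∧ allᵇ p xs

lowB : ℕ → ℤ
lowB k = - (+ (suc k / 2))

upB : ℕ → ℤ
upB k = + (k / 2)

inStrip : ℕ → ℤ → Bool
inStrip k y = (lowB k ≤ᵇ y) ∧ (y ≤ᵇ upB k)

endOk : ℤ → Bool
endOk y = (- (+ 1) ≤ᵇ y) ∧ (y ≤ᵇ + 0)

inA : ℕ → List Step → Bool
inA k v = allᵇ (inStrip k) (heights (+ 0) v) ∧ endOk (endHeight (+ 0) v)

-- number of extremal points: peaks of height ≥ 1 and valleys of height ≤ -2
-- (h is the height of the vertex before the first remaining step)
extremal : ℤ → List Step → ℕ
extremal h []            = 0
extremal h (U ∷ [])      = 0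
extremal h (D ∷ [])      = 0
extremal h (U ∷ U ∷ v)   = extremal (move U h) (U ∷ v)
extremal h (U ∷ D ∷ v)   =
  (if + 1 ≤ᵇ move U h then 1 else 0) ℕ.+ extremal (move U h) (D ∷ v)
extremal h (D ∷ U ∷ v)   =
  (if move D h ≤ᵇ - (+ 2) then 1 else 0) ℕ.+ extremal (move D h) (U ∷ v)
extremal h (D ∷ D ∷ v)   = extremal (move D h) (D ∷ v)

e : List Step → ℕ
e v = extremal (+ 0) v

A : ℕ → ℕ → List (List Step)
A n k = filterᵇ (inA k) (paths n)

-- coefficient of t^m in a(n,k,t): number of v ∈ A_{n,k} with e(v) = m
aCoeff : ℕ → ℕ → ℕ → ℕ
aCoeff n k m = length (filterᵇ (λ v → e v ℕ.≡ᵇ m) (A n k))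

-- Formal power series in x and t over ℤ:  f n m = coefficient of x^n t^m.
-- (ℤ[t][[x]] embeds in ℤ[[x,t]]; all series below lie in ℤ[t][[x]].)

PS : Set
PS = ℕ → ℕ → ℤ

sumTo : ℕ → (ℕ → ℤ) → ℤ
sumTo zero    f = f 0
sumTo (suc n) f = sumTo n f ℤ.+ f (suc n)

_⊕_ : PS → PS → PS
(f ⊕ g) n m = f n m ℤ.+ g n m

⊖_ : PS → PS
(⊖ f) n m = ℤ.- f n m

_⊝_ : PS → PS → PS
f ⊝ g = f ⊕ (⊖ g)

_⊛_ : PS → PS → PS
(f ⊛ g) n m = sumTo n λ i → sumTo m λ j → f i j ℤ.* g (n ∸ i) (m ∸ j)

infixl 6 _⊕_ _⊝_
infixl 7 _⊛_

mono : ℤ → ℕ → ℕ → PS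
mono c a b n m = if (n ℕ.≡ᵇ a) ∧ (m ℕ.≡ᵇ b) then c else + 0

𝟙 𝕩 𝕥 𝟘 : PS
𝟙 = mono (+ 1) 0 0
𝕩 = mono (+ 1) 1 0
𝕥 = mono (+ 1) 0 1
𝟘 _ _ = + 0

fib : PS → PS → ℕ → PS
fib p q zero          = 𝟘
fib p q (suc zero)    = 𝟙
fib p q (suc (suc n)) = p ⊛ fib p q (suc n) ⊕ q ⊛ fib p q n

luc : PS → PS → ℕ → PS
luc p q zero          = 𝟙 ⊕ 𝟙
luc p q (suc zero)    = p
luc p q (suc (suc n)) = p ⊛ luc p q (suc n) ⊕ q ⊛ luc p q n

x² : PS
x² = 𝕩 ⊛ 𝕩

argP argQ : PS
argP = 𝟙 ⊕ (𝟙 ⊝ 𝕥) ⊛ x²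
argQ = ⊖ x²

Φ Λ : ℕ → PS
Φ n = fib argP argQ n
Λ n = luc argP argQ n

genA : ℕ → PS
genA k n m = + aCoeff n k m

-- Let G y p be the generating function of the admissible continuations of a path from a vertex
-- of height y reached by step p.  Splitting off the first step gives one linear equation for each
-- height y and step p, with a factor t for every step that creates an extremal point, and G = 0
-- just outside the strip.  Walking inwards from either wall, the ratio of the unknowns on adjacent
-- levels at distance j from the wall is x t Φ j / Ψ j, where Ψ j = Φ (j + 1) − (1 − t) x² Φ j;
-- this follows by induction from the Fibonacci recurrence.  Substituting both ratios into the
-- equations at the end heights 0 and −1 leaves a single linear equation for G (+ 0) U, the
-- generating function of the statement, whose coefficients become the stated Fibonacci and Lucas
-- expressions through Λ n = 2 Φ (n + 1) − (1 + (1 − t) x²) Φ n.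

module Submission where

open import Defs

open import Algebra.Bundles using (CommutativeRing)
open import Algebra.Solver.Ring.AlmostCommutativeRing
  using (_-Raw-AlmostCommutative⟶_; fromCommutativeRing)
open import Data.Bool using (Bool; true; false; _∧_; if_then_else_)
open import Data.Bool.Properties using (∧-zeroʳ; ∧-identityʳ)
open import Data.Integer as ℤ using (ℤ; +_; -[1+_])
import Data.Integer.Properties as ℤP
open import Data.List using (List; []; _∷_; map; _++_; length; filterᵇ)
open import Data.Maybe as Maybe using (Maybe)
open import Data.Nat as ℕ using (ℕ; zero; suc; _∸_; _≤_; z≤n; s≤s)
open import Data.Nat.DivMod using (/-congˡ; m*n/n≡m; m*n%n≡0; +-distrib-/)
import Data.Nat.Properties as ℕP
open import Data.Product using (_,_)
open import Function using (_$_; _∘_)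
open import Level using (0ℓ)
open import Relation.Binary.PropositionalEquality as ≡ using (_≡_)
open import Relation.Nullary.Decidable using (dec⇒maybe)
open import Relation.Nullary.Reflects using (det; ofʸ; ofⁿ)

module Convolution {c ℓ} (R : CommutativeRing c ℓ) where
  open CommutativeRing R
  open import Algebra.Properties.CommutativeSemigroup +-commutativeSemigroup
    using (interchange; xy∙z≈xz∙y)
  import Algebra.Construct.Pointwise ℕ as Pointwise
  open import Relation.Binary.Reasoning.Setoid setoid

  ∑ : ℕ → (ℕ → Carrier) → Carrier
  ∑ zero    f = f 0
  ∑ (suc n) f = ∑ n f + f (suc n)

  ∑-cong-≤ : ∀ n {f g : ℕ → Carrier} → (∀ {i} → i ≤ n → f i ≈ g i) → ∑ n f ≈ ∑ n g
  ∑-cong-≤ zero    f≈g = f≈g z≤n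
  ∑-cong-≤ (suc n) f≈g = +-cong (∑-cong-≤ n (f≈g ∘ ℕP.m≤n⇒m≤1+n)) (f≈g ℕP.≤-refl)

  ∑-cong : ∀ n {f g : ℕ → Carrier} → (∀ i → f i ≈ g i) → ∑ n f ≈ ∑ n g
  ∑-cong n f≈g = ∑-cong-≤ n (λ {i} _ → f≈g i)

  ∑-distrib-+ : ∀ n (f g : ℕ → Carrier) → ∑ n (λ i → f i + g i) ≈ ∑ n f + ∑ n g
  ∑-distrib-+ zero    f g = refl
  ∑-distrib-+ (suc n) f g = trans (+-congʳ (∑-distrib-+ n f g)) (interchange _ _ _ _)

  *-distribˡ-∑ : ∀ n a (f : ℕ → Carrier) → a * ∑ n f ≈ ∑ n (λ i → a * f i)
  *-distribˡ-∑ zero    a f = refl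
  *-distribˡ-∑ (suc n) a f = trans (distribˡ a _ _) (+-congʳ (*-distribˡ-∑ n a f))

  ∑-zero : ∀ n → ∑ n (λ _ → 0#) ≈ 0#
  ∑-zero zero    = refl
  ∑-zero (suc n) = trans (+-identityʳ _) (∑-zero n)

  ∑-suc : ∀ n (f : ℕ → Carrier) → ∑ (suc n) f ≈ f 0 + ∑ n (λ i → f (suc i))
  ∑-suc zero    f = refl
  ∑-suc (suc n) f = trans (+-congʳ (∑-suc n f)) (+-assoc _ _ _)

  ∑-reverse : ∀ n (f : ℕ → Carrier) → ∑ n f ≈ ∑ n (λ i → f (n ∸ i))
  ∑-reverse zero    f = refl
  ∑-reverse (suc n) f = begin
    ∑ n f + f (suc n)                   ≈⟨ +-comm _ _ ⟩
    f (suc n) + ∑ n f                   ≈⟨ +-congˡ (∑-reverse n f) ⟩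
    f (suc n) + ∑ n (λ i → f (n ∸ i))   ≈⟨ ∑-suc n _ ⟨
    ∑ (suc n) (λ i → f (suc n ∸ i))     ∎

  ∑-triangle-swap : ∀ n (T : ℕ → ℕ → Carrier) →
    ∑ n (λ i → ∑ (n ∸ i) (T i)) ≈ ∑ n (λ j → ∑ (n ∸ j) (λ i → T i j))
  ∑-triangle-swap zero    T = refl
  ∑-triangle-swap (suc n) T = begin
    ∑ (suc n) (λ i → ∑ (suc n ∸ i) (T i))
      ≈⟨ ∑-suc n _ ⟩
    (∑ n (T 0) + T 0 (suc n)) + ∑ n (λ i → ∑ (n ∸ i) (T (suc i)))
      ≈⟨ +-congˡ (∑-triangle-swap n (T ∘ suc)) ⟩
    (∑ n (T 0) + T 0 (suc n)) + ∑ n (λ j → ∑ (n ∸ j) (λ i → T (suc i) j))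
      ≈⟨ xy∙z≈xz∙y _ _ _ ⟩
    (∑ n (T 0) + ∑ n (λ j → ∑ (n ∸ j) (λ i → T (suc i) j))) + T 0 (suc n)
      ≈⟨ +-congʳ (∑-distrib-+ n _ _) ⟨
    ∑ n (λ j → T 0 j + ∑ (n ∸ j) (λ i → T (suc i) j)) + T 0 (suc n)
      ≈⟨ +-cong (∑-cong-≤ n split) single ⟨
    ∑ (suc n) (λ j → ∑ (suc n ∸ j) (λ i → T i j)) ∎
    where
    single : ∑ (n ∸ n) (λ i → T i (suc n)) ≈ T 0 (suc n)
    single = reflexive (≡.cong (λ m → ∑ m (λ i → T i (suc n))) (ℕP.n∸n≡0 n))
    split : ∀ {j} → j ≤ n → ∑ (suc n ∸ j) (λ i → T i j) ≈ T 0 j + ∑ (n ∸ j) (λ i → T (suc i) j)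
    split {j} j≤n = trans (reflexive (≡.cong (λ m → ∑ m (λ i → T i j)) (ℕP.+-∸-assoc 1 j≤n)))
                          (∑-suc (n ∸ j) (λ i → T i j))

  Series : Set c
  Series = ℕ → Carrier

  infix  4 _≈ₛ_
  infixl 6 _+ₛ_
  infixl 7 _*ₛ_

  _≈ₛ_ : Series → Series → Set ℓ
  f ≈ₛ g = ∀ n → f n ≈ g n

  _+ₛ_ _*ₛ_ : Series → Series → Series
  (f +ₛ g) n = f n + g n
  (f *ₛ g) n = ∑ n (λ i → f i * g (n ∸ i))

  -ₛ_ : Series → Series
  (-ₛ f) n = - f n

  0ₛ : Series
  0ₛ _ = 0#

  C : Carrier → Series
  C a zero    = a
  C a (suc _) = 0#

  1ₛ : Series
  1ₛ = C 1#

  X : Series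
  X zero    = 0#
  X (suc n) = 1ₛ n

  *ₛ-cong : ∀ {f f′ g g′} → f ≈ₛ f′ → g ≈ₛ g′ → f *ₛ g ≈ₛ f′ *ₛ g′
  *ₛ-cong f≈f′ g≈g′ n = ∑-cong n (λ i → *-cong (f≈f′ i) (g≈g′ (n ∸ i)))

  *ₛ-comm : ∀ f g → f *ₛ g ≈ₛ g *ₛ f
  *ₛ-comm f g n = begin
    ∑ n (λ i → f i * g (n ∸ i))              ≈⟨ ∑-reverse n _ ⟩
    ∑ n (λ i → f (n ∸ i) * g (n ∸ (n ∸ i)))  ≈⟨ ∑-cong-≤ n swap ⟩
    ∑ n (λ i → g i * f (n ∸ i))              ∎
    where
    swap : ∀ {i} → i ≤ n → f (n ∸ i) * g (n ∸ (n ∸ i)) ≈ g i * f (n ∸ i)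
    swap i≤n = trans (*-comm _ _) (*-congʳ (reflexive (≡.cong g (ℕP.m∸[m∸n]≡n i≤n))))

  private
    ∸-comm : ∀ n a b → n ∸ a ∸ b ≡ n ∸ b ∸ a
    ∸-comm n a b = ≡.trans (ℕP.∸-+-assoc n a b)
      (≡.trans (≡.cong (n ∸_) (ℕP.+-comm a b)) (≡.sym (ℕP.∸-+-assoc n b a)))

  *ₛ-exchange : ∀ f g h → h *ₛ (f *ₛ g) ≈ₛ f *ₛ (h *ₛ g)
  *ₛ-exchange f g h n = begin
    ∑ n (λ a → h a * ∑ (n ∸ a) (λ b → f b * g (n ∸ a ∸ b)))
      ≈⟨ ∑-cong n (λ a → *-distribˡ-∑ (n ∸ a) (h a) _) ⟩
    ∑ n (λ a → ∑ (n ∸ a) (λ b → h a * (f b * g (n ∸ a ∸ b))))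
      ≈⟨ ∑-triangle-swap n _ ⟩
    ∑ n (λ b → ∑ (n ∸ b) (λ a → h a * (f b * g (n ∸ a ∸ b))))
      ≈⟨ ∑-cong n (λ b → ∑-cong (n ∸ b) (λ a → exchange a b)) ⟩
    ∑ n (λ b → ∑ (n ∸ b) (λ a → f b * (h a * g (n ∸ b ∸ a))))
      ≈⟨ ∑-cong n (λ b → *-distribˡ-∑ (n ∸ b) (f b) _) ⟨
    ∑ n (λ b → f b * ∑ (n ∸ b) (λ a → h a * g (n ∸ b ∸ a))) ∎
    where
    exchange : ∀ a b → h a * (f b * g (n ∸ a ∸ b)) ≈ f b * (h a * g (n ∸ b ∸ a))
    exchange a b = begin
      h a * (f b * g (n ∸ a ∸ b))  ≈⟨ *-assoc _ _ _ ⟨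
      (h a * f b) * g (n ∸ a ∸ b)  ≈⟨ *-cong (*-comm _ _) (reflexive (≡.cong g (∸-comm n a b))) ⟩
      (f b * h a) * g (n ∸ b ∸ a)  ≈⟨ *-assoc _ _ _ ⟩
      f b * (h a * g (n ∸ b ∸ a))  ∎

  *ₛ-assoc : ∀ f g h → (f *ₛ g) *ₛ h ≈ₛ f *ₛ (g *ₛ h)
  *ₛ-assoc f g h n = begin
    ((f *ₛ g) *ₛ h) n  ≈⟨ *ₛ-comm (f *ₛ g) h n ⟩
    (h *ₛ (f *ₛ g)) n  ≈⟨ *ₛ-exchange f g h n ⟩
    (f *ₛ (h *ₛ g)) n  ≈⟨ *ₛ-cong (λ _ → refl) (*ₛ-comm h g) n ⟩
    (f *ₛ (g *ₛ h)) n  ∎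

  C-*ₛ : ∀ a f n → (C a *ₛ f) n ≈ a * f n
  C-*ₛ a f zero    = refl
  C-*ₛ a f (suc n) = begin
    ∑ (suc n) (λ i → C a i * f (suc n ∸ i))
      ≈⟨ ∑-suc n _ ⟩
    a * f (suc n) + ∑ n (λ i → 0# * f (n ∸ i))
      ≈⟨ +-congˡ (trans (∑-cong n (λ _ → zeroˡ _)) (∑-zero n)) ⟩
    a * f (suc n) + 0#
      ≈⟨ +-identityʳ _ ⟩
    a * f (suc n) ∎

  *ₛ-identityˡ : ∀ f → 1ₛ *ₛ f ≈ₛ f
  *ₛ-identityˡ f n = trans (C-*ₛ 1# f n) (*-identityˡ (f n))

  *ₛ-distribˡ : ∀ f g h → f *ₛ (g +ₛ h) ≈ₛ f *ₛ g +ₛ f *ₛ h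
  *ₛ-distribˡ f g h n = trans (∑-cong n (λ i → distribˡ (f i) _ _)) (∑-distrib-+ n _ _)

  X-*ₛ-zero : ∀ f → (X *ₛ f) 0 ≈ 0#
  X-*ₛ-zero f = zeroˡ (f 0)

  X-*ₛ-suc : ∀ f n → (X *ₛ f) (suc n) ≈ f n
  X-*ₛ-suc f n = begin
    (X *ₛ f) (suc n)                  ≈⟨ ∑-suc n _ ⟩
    0# * f (suc n) + (1ₛ *ₛ f) n      ≈⟨ +-congʳ (zeroˡ _) ⟩
    0# + (1ₛ *ₛ f) n                  ≈⟨ +-identityˡ _ ⟩
    (1ₛ *ₛ f) n                       ≈⟨ *ₛ-identityˡ f n ⟩
    f n                               ∎

  convolutionRing : CommutativeRing c ℓ
  convolutionRing = record
    { Carrier = Series ; _≈_ = _≈ₛ_ ; _+_ = _+ₛ_ ; _*_ = _*ₛ_ ; -_ = -ₛ_ ; 0# = 0ₛ ; 1# = 1ₛ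
    ; isCommutativeRing = record
      { isRing = record
        { +-isAbelianGroup = Pointwise.isAbelianGroup +-isAbelianGroup
        ; *-cong           = *ₛ-cong
        ; *-assoc          = *ₛ-assoc
        ; *-identity       = *ₛ-identityˡ , *ₛ-identityʳ
        ; distrib          = *ₛ-distribˡ , *ₛ-distribʳ
        }
      ; *-comm = *ₛ-comm
      }
    }
    where
    *ₛ-identityʳ : ∀ f → f *ₛ 1ₛ ≈ₛ f
    *ₛ-identityʳ f n = trans (*ₛ-comm f 1ₛ n) (*ₛ-identityˡ f n)
    *ₛ-distribʳ : ∀ f g h → (g +ₛ h) *ₛ f ≈ₛ g *ₛ f +ₛ h *ₛ f
    *ₛ-distribʳ f g h n = trans (*ₛ-comm (g +ₛ h) f n)
      (trans (*ₛ-distribˡ f g h n) (+-cong (*ₛ-comm f g n) (*ₛ-comm f h n)))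

module ℤ⟦t⟧ = Convolution ℤP.+-*-commutativeRing
module ℤ⟦t⟧⟦x⟧ = Convolution ℤ⟦t⟧.convolutionRing

infix 4 _≋_
_≋_ : PS → PS → Set
f ≋ g = ∀ n m → f n m ≡ g n m

sumTo≡∑ : ∀ n f → sumTo n f ≡ ℤ⟦t⟧.∑ n f
sumTo≡∑ zero    f = ≡.refl
sumTo≡∑ (suc n) f = ≡.cong (ℤ._+ f (suc n)) (sumTo≡∑ n f)

∑-coeff : ∀ n (F : ℕ → ℤ⟦t⟧.Series) m → ℤ⟦t⟧⟦x⟧.∑ n F m ≡ sumTo n (λ i → F i m)
∑-coeff zero    F m = ≡.refl
∑-coeff (suc n) F m = ≡.cong (ℤ._+ F (suc n) m) (∑-coeff n F m)

⊛≋*ₛ : ∀ f g → f ⊛ g ≋ f ℤ⟦t⟧⟦x⟧.*ₛ g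
⊛≋*ₛ f g n m = ≡.sym (≡.trans (∑-coeff n _ m) (sumTo-cong n (λ i → ≡.sym (sumTo≡∑ m _))))
  where
  sumTo-cong : ∀ n {f g : ℕ → ℤ} → (∀ i → f i ≡ g i) → sumTo n f ≡ sumTo n g
  sumTo-cong zero    f≡g = f≡g 0
  sumTo-cong (suc n) f≡g = ≡.cong₂ ℤ._+_ (sumTo-cong n f≡g) (f≡g (suc n))

private
  module Conv = CommutativeRing ℤ⟦t⟧⟦x⟧.convolutionRing

mono≋C : ∀ c → mono c 0 0 ≋ ℤ⟦t⟧⟦x⟧.C (ℤ⟦t⟧.C c)
mono≋C c zero    zero    = ≡.refl
mono≋C c zero    (suc m) = ≡.refl
mono≋C c (suc n) m       = ≡.refl

𝕩≋X : 𝕩 ≋ ℤ⟦t⟧⟦x⟧.X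
𝕩≋X zero          m       = ≡.refl
𝕩≋X 1             zero    = ≡.refl
𝕩≋X 1             (suc m) = ≡.refl
𝕩≋X (suc (suc n)) m       = ≡.refl

𝕥≋CX : 𝕥 ≋ ℤ⟦t⟧⟦x⟧.C ℤ⟦t⟧.X
𝕥≋CX zero    zero          = ≡.refl
𝕥≋CX zero    1             = ≡.refl
𝕥≋CX zero    (suc (suc m)) = ≡.refl
𝕥≋CX (suc n) m             = ≡.refl

⊛≋*ₛˡ : ∀ {f g} F → f ≋ g → f ⊛ F ≋ g ℤ⟦t⟧⟦x⟧.*ₛ F
⊛≋*ₛˡ {f} F f≋g = Conv.trans (⊛≋*ₛ f F) (Conv.*-congʳ {F} f≋g)

⊛-cong : ∀ {f f′ g g′} → f ≋ f′ → g ≋ g′ → f ⊛ g ≋ f′ ⊛ g′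
⊛-cong {f} {f′} {g} {g′} f≋f′ g≋g′ =
  Conv.trans (⊛≋*ₛ f g) (Conv.trans (Conv.*-cong f≋f′ g≋g′) (Conv.sym (⊛≋*ₛ f′ g′)))

⊛-comm : ∀ f g → f ⊛ g ≋ g ⊛ f
⊛-comm f g = Conv.trans (⊛≋*ₛ f g) (Conv.trans (Conv.*-comm f g) (Conv.sym (⊛≋*ₛ g f)))

⊛-assoc : ∀ f g h → (f ⊛ g) ⊛ h ≋ f ⊛ (g ⊛ h)
⊛-assoc f g h = Conv.trans (⊛≋*ₛ (f ⊛ g) h) (Conv.trans (Conv.*-congʳ {h} (⊛≋*ₛ f g))
  (Conv.trans (Conv.*-assoc f g h)
    (Conv.sym (Conv.trans (⊛≋*ₛ f (g ⊛ h)) (Conv.*-congˡ {f} (⊛≋*ₛ g h))))))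

⊛-identityˡ : ∀ f → 𝟙 ⊛ f ≋ f
⊛-identityˡ f = Conv.trans (⊛≋*ₛˡ f (mono≋C (+ 1))) (Conv.*-identityˡ f)

⊛-distribˡ : ∀ f g h → f ⊛ (g ⊕ h) ≋ f ⊛ g ⊕ f ⊛ h
⊛-distribˡ f g h = Conv.trans (⊛≋*ₛ f (g ⊕ h))
  (Conv.trans (Conv.distribˡ f g h) (Conv.sym (Conv.+-cong (⊛≋*ₛ f g) (⊛≋*ₛ f h))))

series-ring : CommutativeRing 0ℓ 0ℓ
series-ring = record
  { Carrier = PS ; _≈_ = _≋_ ; _+_ = _⊕_ ; _*_ = _⊛_ ; -_ = ⊖_ ; 0# = 𝟘 ; 1# = 𝟙
  ; isCommutativeRing = record
    { isRing = record
      { +-isAbelianGroup = Conv.+-isAbelianGroup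
      ; *-cong           = ⊛-cong
      ; *-assoc          = ⊛-assoc
      ; *-identity       = comm∧idˡ⇒id ⊛-comm {𝟙} ⊛-identityˡ
      ; distrib          = comm∧distrˡ⇒distr {_⊛_} {_⊕_} Conv.+-cong ⊛-comm ⊛-distribˡ
      }
    ; *-comm = ⊛-comm
    }
  }
  where open import Algebra.Consequences.Setoid Conv.setoid using (comm∧idˡ⇒id; comm∧distrˡ⇒distr)

𝕩⊛-coeff-zero : ∀ F m → (𝕩 ⊛ F) 0 m ≡ + 0
𝕩⊛-coeff-zero F m = ≡.trans (⊛≋*ₛˡ F 𝕩≋X 0 m) (ℤ⟦t⟧⟦x⟧.X-*ₛ-zero F m)

𝕩⊛-coeff-suc : ∀ F n m → (𝕩 ⊛ F) (suc n) m ≡ F n m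
𝕩⊛-coeff-suc F n m = ≡.trans (⊛≋*ₛˡ F 𝕩≋X (suc n) m) (ℤ⟦t⟧⟦x⟧.X-*ₛ-suc F n m)

𝕥⊛≋X*ₛ : ∀ F n m → (𝕥 ⊛ F) n m ≡ (ℤ⟦t⟧.X ℤ⟦t⟧.*ₛ F n) m
𝕥⊛≋X*ₛ F n m = ≡.trans (⊛≋*ₛˡ F 𝕥≋CX n m) (ℤ⟦t⟧⟦x⟧.C-*ₛ ℤ⟦t⟧.X F n m)

𝕥⊛-coeff-zero : ∀ F n → (𝕥 ⊛ F) n 0 ≡ + 0
𝕥⊛-coeff-zero F n = ≡.trans (𝕥⊛≋X*ₛ F n 0) (ℤ⟦t⟧.X-*ₛ-zero (F n))

𝕥⊛-coeff-suc : ∀ F n m → (𝕥 ⊛ F) n (suc m) ≡ F n m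
𝕥⊛-coeff-suc F n m = ≡.trans (𝕥⊛≋X*ₛ F n (suc m)) (ℤ⟦t⟧.X-*ₛ-suc (F n) m)

mono⊛-coeff : ∀ c F n m → (mono c 0 0 ⊛ F) n m ≡ c ℤ.* F n m
mono⊛-coeff c F n m =
  ≡.trans (⊛≋*ₛˡ F (mono≋C c) n m) (≡.trans (ℤ⟦t⟧⟦x⟧.C-*ₛ (ℤ⟦t⟧.C c) F n m) (ℤ⟦t⟧.C-*ₛ c (F n) m))

-- The solver's constants 0 and 1 must denote 𝟘 and 𝟙 on the nose, hence the special case.
ι : ℤ → PS
ι (+ 0) = 𝟘
ι c     = mono c 0 0

ι≋mono : ∀ c → ι c ≋ mono c 0 0
ι≋mono (+ 0)     zero    zero    = ≡.refl
ι≋mono (+ 0)     zero    (suc m) = ≡.refl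
ι≋mono (+ 0)     (suc n) m       = ≡.refl
ι≋mono (+ suc c) n       m       = ≡.refl
ι≋mono -[1+ c ]  n       m       = ≡.refl

private
  module S = CommutativeRing series-ring

  mono-+ : ∀ a b → mono (a ℤ.+ b) 0 0 ≋ mono a 0 0 ⊕ mono b 0 0
  mono-+ a b zero    zero    = ≡.refl
  mono-+ a b zero    (suc m) = ≡.refl
  mono-+ a b (suc n) m       = ≡.refl

  mono-* : ∀ a b → mono (a ℤ.* b) 0 0 ≋ mono a 0 0 ⊛ mono b 0 0
  mono-* a b n m = ≡.sym (≡.trans (mono⊛-coeff a (mono b 0 0) n m) (scale n m))
    where
    scale : ∀ n m → a ℤ.* mono b 0 0 n m ≡ mono (a ℤ.* b) 0 0 n m
    scale zero    zero    = ≡.refl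
    scale zero    (suc m) = ℤP.*-zeroʳ a
    scale (suc n) m       = ℤP.*-zeroʳ a

  mono-neg : ∀ a → mono (ℤ.- a) 0 0 ≋ ⊖ mono a 0 0
  mono-neg a zero    zero    = ≡.refl
  mono-neg a zero    (suc m) = ≡.refl
  mono-neg a (suc n) m       = ≡.refl

  ι-homomorphism : CommutativeRing.rawRing ℤP.+-*-commutativeRing
                     -Raw-AlmostCommutative⟶ fromCommutativeRing series-ring
  ι-homomorphism = record
    { ⟦_⟧    = ι
    ; +-homo = λ a b → via (a ℤ.+ b) (S.trans (mono-+ a b) (S.sym (S.+-cong (ι≋mono a) (ι≋mono b))))
    ; *-homo = λ a b → via (a ℤ.* b) (S.trans (mono-* a b) (S.sym (S.*-cong (ι≋mono a) (ι≋mono b))))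
    ; -‿homo = λ a → via (ℤ.- a) (S.trans (mono-neg a) (S.sym (S.-‿cong (ι≋mono a))))
    ; 0-homo = S.refl
    ; 1-homo = S.refl
    }
    where
    via : ∀ c {f} → mono c 0 0 ≋ f → ι c ≋ f
    via c = S.trans (ι≋mono c)

  ι-equal? : ∀ a b → Maybe (ι a ≋ ι b)
  ι-equal? a b = Maybe.map (λ a≡b → S.reflexive (≡.cong ι a≡b)) (dec⇒maybe (a ℤ.≟ b))

open import Algebra.Solver.Ring (CommutativeRing.rawRing ℤP.+-*-commutativeRing)
  (fromCommutativeRing series-ring) ι-homomorphism ι-equal?
  using (Polynomial; solve; _:=_; _:+_; _:*_; _:-_; :-_; con)

open import Relation.Binary.Reasoning.Setoid S.setoid

luc-via-fib : ∀ p q n → luc p q n ≋ (𝟙 ⊕ 𝟙) ⊛ fib p q (suc n) ⊝ p ⊛ fib p q n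
luc-via-fib p q zero =
  solve 1 (λ p → ⌜2⌝ := ⌜2⌝ :* ⌜1⌝ :- p :* ⌜0⌝) (λ _ _ → ≡.refl) p
  where ⌜0⌝ = con (+ 0); ⌜1⌝ = con (+ 1); ⌜2⌝ = ⌜1⌝ :+ ⌜1⌝
luc-via-fib p q (suc zero) =
  solve 2 (λ p q → p := ⌜2⌝ :* (p :* ⌜1⌝ :+ q :* ⌜0⌝) :- p :* ⌜1⌝) (λ _ _ → ≡.refl) p q
  where ⌜0⌝ = con (+ 0); ⌜1⌝ = con (+ 1); ⌜2⌝ = ⌜1⌝ :+ ⌜1⌝
luc-via-fib p q (suc (suc n)) = begin
  p ⊛ luc p q (suc n) ⊕ q ⊛ luc p q n
    ≈⟨ S.+-cong (S.*-congˡ {p} (luc-via-fib p q (suc n))) (S.*-congˡ {q} (luc-via-fib p q n)) ⟩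
  p ⊛ ((𝟙 ⊕ 𝟙) ⊛ f₂ ⊝ p ⊛ f₁) ⊕ q ⊛ ((𝟙 ⊕ 𝟙) ⊛ f₁ ⊝ p ⊛ f₀)
    ≈⟨ solve 4 (λ p q f₀ f₁ → let f₂ = p :* f₁ :+ q :* f₀ in
           p :* (⌜2⌝ :* f₂ :- p :* f₁) :+ q :* (⌜2⌝ :* f₁ :- p :* f₀)
        := ⌜2⌝ :* (p :* f₂ :+ q :* f₁) :- p :* f₂)
       (λ _ _ → ≡.refl) p q f₀ f₁ ⟩
  (𝟙 ⊕ 𝟙) ⊛ fib p q (suc (suc (suc n))) ⊝ p ⊛ f₂ ∎
  where
  f₀ = fib p q n; f₁ = fib p q (suc n); f₂ = fib p q (suc (suc n))
  ⌜2⌝ = con (+ 1) :+ con (+ 1)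

-- At distance j from a wall, x t Φ j / Ψ j is the ratio of the series of adjacent levels.
Ψ : ℕ → PS
Ψ j = Φ (suc j) ⊝ (𝟙 ⊝ 𝕥) ⊛ x² ⊛ Φ j

-- Solver syntax for Φ (j + 2), Ψ j and Ψ (j + 1), given f₀ = Φ j and f₁ = Φ (j + 1).
module _ {m : ℕ} where

  ⌜Φ⁺⌝ ⌜Ψ⌝ : (f₀ f₁ x t : Polynomial m) → Polynomial m
  ⌜Φ⁺⌝ f₀ f₁ x t = (con (+ 1) :+ (con (+ 1) :- t) :* (x :* x)) :* f₁ :+ :- (x :* x) :* f₀
  ⌜Ψ⌝  f₀ f₁ x t = f₁ :- (con (+ 1) :- t) :* (x :* x) :* f₀

  ⌜Ψ⁺⌝ : (f₀ f₁ x t : Polynomial m) → Polynomial m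
  ⌜Ψ⁺⌝ f₀ f₁ x t = ⌜Ψ⌝ f₁ (⌜Φ⁺⌝ f₀ f₁ x t) x t

Λ-denominator : ∀ j → Λ (suc j) ⊝ x² ⊛ Λ j ≋ Ψ (suc j) ⊝ 𝕥 ⊛ x² ⊛ Φ (suc j) ⊝ x² ⊛ Ψ j
Λ-denominator j = S.trans
  (S.+-cong (luc-via-fib argP argQ (suc j)) (S.-‿cong (S.*-congˡ {x²} (luc-via-fib argP argQ j))))
  (solve 4 (λ f₀ f₁ x t →
     let P = con (+ 1) :+ (con (+ 1) :- t) :* (x :* x)
         ⌜2⌝ = con (+ 1) :+ con (+ 1)
     in     (⌜2⌝ :* ⌜Φ⁺⌝ f₀ f₁ x t :- P :* f₁) :- x :* x :* (⌜2⌝ :* f₁ :- P :* f₀)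
         := ⌜Ψ⁺⌝ f₀ f₁ x t :- t :* (x :* x) :* f₁ :- x :* x :* ⌜Ψ⌝ f₀ f₁ x t)
     (λ _ _ → ≡.refl) (Φ j) (Φ (suc j)) 𝕩 𝕥)

numerator-via-Ψ : ∀ j →
  (𝟙 ⊕ 𝕩) ⊛ Φ (suc j) ⊝ x² ⊛ (𝟙 ⊕ (𝟙 ⊝ 𝕥) ⊛ 𝕩) ⊛ Φ j ≋ Ψ (suc j) ⊕ 𝕩 ⊛ Ψ j
numerator-via-Ψ j =
  solve 4 (λ f₀ f₁ x t →
        (con (+ 1) :+ x) :* f₁ :- x :* x :* (con (+ 1) :+ (con (+ 1) :- t) :* x) :* f₀
     := ⌜Ψ⁺⌝ f₀ f₁ x t :+ x :* ⌜Ψ⌝ f₀ f₁ x t)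
    (λ _ _ → ≡.refl) (Φ j) (Φ (suc j)) 𝕩 𝕥

-- The certificates below write L as ∑ cᵢ (aᵢ − bᵢ) + R, a form the ring solver checks.
linear-combination : ∀ {L R a b} c → a ≋ b → L ≋ c ⊛ (a ⊝ b) ⊕ R → L ≋ R
linear-combination {L} {R} {a} {b} c a≋b L≋ = begin
  L                ≈⟨ L≋ ⟩
  c ⊛ (a ⊝ b) ⊕ R  ≈⟨ S.+-congʳ (S.*-congˡ {c} (S.trans (S.+-congʳ a≋b) (S.-‿inverseʳ b))) ⟩
  c ⊛ 𝟘 ⊕ R        ≈⟨ S.+-congʳ (S.zeroʳ c) ⟩
  𝟘 ⊕ R            ≈⟨ S.+-identityˡ R ⟩
  R                ∎

ratio-step : ∀ j {a a′ b c} →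
  Ψ j ⊛ a′ ≋ 𝕩 ⊛ 𝕥 ⊛ Φ j ⊛ b →
  a ≋ 𝕩 ⊛ a′ ⊕ 𝕩 ⊛ 𝕥 ⊛ c →
  b ≋ 𝕩 ⊛ a′ ⊕ 𝕩 ⊛ c →
  Ψ (suc j) ⊛ a ≋ 𝕩 ⊛ 𝕥 ⊛ Φ (suc j) ⊛ c
ratio-step j {a} {a′} {b} {c} ratio eq-a eq-b =
  linear-combination (𝕩 ⊛ 𝕩 ⊛ 𝕥 ⊛ Φ j) eq-b $ linear-combination 𝕩 ratio $
  linear-combination (Ψ (suc j)) eq-a $
  solve 8 (λ f₀ f₁ a a′ b c x t →
       ⌜Ψ⁺⌝ f₀ f₁ x t :* a
    := ⌜Ψ⁺⌝ f₀ f₁ x t :* (a :- (x :* a′ :+ x :* t :* c))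
       :+ (x :* (⌜Ψ⌝ f₀ f₁ x t :* a′ :- x :* t :* f₀ :* b)
       :+ (x :* x :* t :* f₀ :* (b :- (x :* a′ :+ x :* c))
       :+ x :* t :* f₁ :* c)))
    (λ _ _ → ≡.refl) (Φ j) (Φ (suc j)) a a′ b c 𝕩 𝕥

-- Levels 1, …, L lie next to a wall at level L + 1; α i and β i belong to a vertex at level i
-- entered by a step towards, respectively away from, the wall.
ratio-from-wall : ∀ L (α β : ℕ → PS) →
  α (suc L) ≋ 𝟘 →
  (∀ {i} → i ℕ.< L → α (suc i) ≋ 𝕩 ⊛ α (suc (suc i)) ⊕ 𝕩 ⊛ 𝕥 ⊛ β i) →
  (∀ {i} → i ℕ.< L → β (suc i) ≋ 𝕩 ⊛ α (suc (suc i)) ⊕ 𝕩 ⊛ β i) →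
  Ψ L ⊛ α 1 ≋ 𝕩 ⊛ 𝕥 ⊛ Φ L ⊛ β 0
ratio-from-wall L α β wall eq-α eq-β = below-wall L 0 (ℕP.+-identityʳ L)
  where
  below-wall : ∀ j i → j ℕ.+ i ≡ L → Ψ j ⊛ α (suc i) ≋ 𝕩 ⊛ 𝕥 ⊛ Φ j ⊛ β i
  below-wall zero    .L ≡.refl = begin
    Ψ 0 ⊛ α (suc L)    ≈⟨ S.trans (S.*-congˡ {Ψ 0} wall) (S.zeroʳ (Ψ 0)) ⟩
    𝟘                  ≈⟨ S.trans (S.*-congʳ {β L} (S.zeroʳ (𝕩 ⊛ 𝕥))) (S.zeroˡ (β L)) ⟨
    𝕩 ⊛ 𝕥 ⊛ Φ 0 ⊛ β L  ∎
  below-wall (suc j) i j+i≡L = ratio-step j {α (suc i)} {α (suc (suc i))} {β (suc i)} {β i}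
    (below-wall j (suc i) (≡.trans (ℕP.+-suc j i) j+i≡L)) (eq-α i<L) (eq-β i<L)
    where
    i<L : i ℕ.< L
    i<L = ≡.subst (i ℕ.<_) j+i≡L (s≤s (ℕP.m≤n+m i j))

end-level-ratio : ∀ j {G H w} →
  H ≋ 𝟙 ⊕ 𝕩 ⊛ G ⊕ 𝕩 ⊛ w →
  Ψ j ⊛ w ≋ 𝕩 ⊛ 𝕥 ⊛ Φ j ⊛ H →
  Ψ (suc j) ⊛ H ≋ Ψ j ⊛ (𝟙 ⊕ 𝕩 ⊛ G)
end-level-ratio j {G} {H} {w} eq-H ratio =
  linear-combination 𝕩 ratio $ linear-combination (Ψ j) eq-H $
  solve 7 (λ f₀ f₁ G H w x t →
       ⌜Ψ⁺⌝ f₀ f₁ x t :* H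
    := ⌜Ψ⌝ f₀ f₁ x t :* (H :- (con (+ 1) :+ x :* G :+ x :* w))
       :+ (x :* (⌜Ψ⌝ f₀ f₁ x t :* w :- x :* t :* f₀ :* H)
       :+ ⌜Ψ⌝ f₀ f₁ x t :* (con (+ 1) :+ x :* G)))
    (λ _ _ → ≡.refl) (Φ j) (Φ (suc j)) G H w 𝕩 𝕥

eliminate-end-levels : ∀ ψ₀ ψ₁ φ₁ {G H u} →
  G ≋ 𝟙 ⊕ 𝕩 ⊛ u ⊕ 𝕩 ⊛ H →
  ψ₁ ⊛ u ≋ 𝕩 ⊛ 𝕥 ⊛ φ₁ ⊛ G →
  ψ₁ ⊛ H ≋ ψ₀ ⊛ (𝟙 ⊕ 𝕩 ⊛ G) →
  G ⊛ (ψ₁ ⊝ 𝕥 ⊛ x² ⊛ φ₁ ⊝ x² ⊛ ψ₀) ≋ ψ₁ ⊕ 𝕩 ⊛ ψ₀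
eliminate-end-levels ψ₀ ψ₁ φ₁ {G} {H} {u} eq-G ratio-u ratio-H =
  linear-combination 𝕩 ratio-H $ linear-combination 𝕩 ratio-u $ linear-combination ψ₁ eq-G $
  solve 8 (λ G H u ψ₀ ψ₁ φ₁ x t →
       G :* (ψ₁ :- t :* (x :* x) :* φ₁ :- x :* x :* ψ₀)
    := ψ₁ :* (G :- (con (+ 1) :+ x :* u :+ x :* H))
       :+ (x :* (ψ₁ :* u :- x :* t :* φ₁ :* G)
       :+ (x :* (ψ₁ :* H :- ψ₀ :* (con (+ 1) :+ x :* G))
       :+ (ψ₁ :+ x :* ψ₀))))
    (λ _ _ → ≡.refl) G H u ψ₀ ψ₁ φ₁ 𝕩 𝕥

count : {A : Set} → (A → Bool) → List A → ℕ
count p xs = length (filterᵇ p xs)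

module _ {A : Set} where

  count-cong : ∀ {p q : A → Bool} → (∀ x → p x ≡ q x) → ∀ xs → count p xs ≡ count q xs
  count-cong p≡q [] = ≡.refl
  count-cong {p} {q} p≡q (x ∷ xs) with p x | q x | p≡q x
  ... | true  | .true  | ≡.refl = ≡.cong suc (count-cong p≡q xs)
  ... | false | .false | ≡.refl = count-cong p≡q xs

  count-none : ∀ {p : A → Bool} → (∀ x → p x ≡ false) → ∀ xs → count p xs ≡ 0
  count-none {p} none xs = ≡.trans (count-cong none xs) (count-false xs)
    where
    count-false : ∀ xs → count (λ _ → false) xs ≡ 0
    count-false []       = ≡.refl
    count-false (_ ∷ xs) = count-false xs

  count-singleton : ∀ (p : A → Bool) x → count p (x ∷ []) ≡ (if p x then 1 else 0)
  count-singleton p x with p x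
  ... | true  = ≡.refl
  ... | false = ≡.refl

  count-++ : ∀ (p : A → Bool) xs ys → count p (xs ++ ys) ≡ count p xs ℕ.+ count p ys
  count-++ p []       ys = ≡.refl
  count-++ p (x ∷ xs) ys with p x
  ... | true  = ≡.cong suc (count-++ p xs ys)
  ... | false = count-++ p xs ys

  count-map : ∀ {B : Set} (p : B → Bool) (f : A → B) xs →
    count p (map f xs) ≡ count (λ x → p (f x)) xs
  count-map p f []       = ≡.refl
  count-map p f (x ∷ xs) with p (f x)
  ... | true  = ≡.cong suc (count-map p f xs)
  ... | false = count-map p f xs

  count-filterᵇ : ∀ (p q : A → Bool) xs → count p (filterᵇ q xs) ≡ count (λ x → q x ∧ p x) xs
  count-filterᵇ p q []       = ≡.refl
  count-filterᵇ p q (x ∷ xs) with q x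
  ... | false = count-filterᵇ p q xs
  ... | true with p x
  ...   | true  = ≡.cong suc (count-filterᵇ p q xs)
  ...   | false = count-filterᵇ p q xs

shiftIf : Bool → (ℕ → ℕ) → ℕ → ℕ
shiftIf false f m       = f m
shiftIf true  f zero    = 0
shiftIf true  f (suc m) = f m

count-shiftIf : ∀ {A : Set} b (q : A → Bool) (f : A → ℕ) xs m →
  count (λ x → q x ∧ (((if b then 1 else 0) ℕ.+ f x) ℕ.≡ᵇ m)) xs
    ≡ shiftIf b (λ m → count (λ x → q x ∧ (f x ℕ.≡ᵇ m)) xs) m
count-shiftIf false q f xs m       = ≡.refl
count-shiftIf true  q f xs zero    = count-none (λ x → ∧-zeroʳ (q x)) xs
count-shiftIf true  q f xs (suc m) = ≡.refl

-- the vertex at height y, entered by step p and left by step s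
extremalAt : ℤ → Step → Step → Bool
extremalAt y U D = + 1 ℤ.≤ᵇ y
extremalAt y D U = y ℤ.≤ᵇ -[1+ 1 ]
extremalAt y U U = false
extremalAt y D D = false

extremalFrom : ℤ → Step → List Step → ℕ
extremalFrom y p []      = 0
extremalFrom y p (s ∷ w) = (if extremalAt y p s then 1 else 0) ℕ.+ extremalFrom (move s y) s w

extremal-∷ : ∀ h s v → extremal h (s ∷ v) ≡ extremalFrom (move s h) s v
extremal-∷ h U []      = ≡.refl
extremal-∷ h D []      = ≡.refl
extremal-∷ h U (U ∷ v) = extremal-∷ (move U h) U v
extremal-∷ h U (D ∷ v) = ≡.cong (_ ℕ.+_) (extremal-∷ (move U h) D v)
extremal-∷ h D (U ∷ v) = ≡.cong (_ ℕ.+_) (extremal-∷ (move D h) U v)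
extremal-∷ h D (D ∷ v) = extremal-∷ (move D h) D v

-- A fictitious up-step into the origin creates no extremal point there.
e≡extremalFrom : ∀ v → e v ≡ extremalFrom (+ 0) U v
e≡extremalFrom []      = ≡.refl
e≡extremalFrom (U ∷ v) = extremal-∷ (+ 0) U v
e≡extremalFrom (D ∷ v) = extremal-∷ (+ 0) D v

admissible : ℕ → ℤ → List Step → Bool
admissible K y w = allᵇ (inStrip K) (heights y w) ∧ endOk (endHeight y w)

suffixCount : ℕ → ℕ → ℤ → Step → ℕ → ℕ
suffixCount K n y p m = count (λ w → admissible K y w ∧ (extremalFrom y p w ℕ.≡ᵇ m)) (paths n)

aCoeff≡suffixCount : ∀ n K m → aCoeff n K m ≡ suffixCount K n (+ 0) U m
aCoeff≡suffixCount n K m = ≡.trans (count-filterᵇ (λ v → e v ℕ.≡ᵇ m) (inA K) (paths n))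
  (count-cong (λ v → ≡.cong (λ z → inA K v ∧ (z ℕ.≡ᵇ m)) (e≡extremalFrom v)) (paths n))

G : ℕ → ℤ → Step → PS
G K y p n m = + suffixCount K n y p m

endTerm : ℤ → PS
endTerm y = if endOk y then 𝟙 else 𝟘

stepWeight : Bool → PS
stepWeight false = 𝕩
stepWeight true  = 𝕩 ⊛ 𝕥

stepWeight-coeff-zero : ∀ b F m → (stepWeight b ⊛ F) 0 m ≡ + 0
stepWeight-coeff-zero false F m = 𝕩⊛-coeff-zero F m
stepWeight-coeff-zero true  F m = ≡.trans (⊛-assoc 𝕩 𝕥 F 0 m) (𝕩⊛-coeff-zero (𝕥 ⊛ F) m)

stepWeight-coeff-suc : ∀ b (f : ℕ → ℕ → ℕ) n m →
  (stepWeight b ⊛ (λ n m → + f n m)) (suc n) m ≡ + shiftIf b (f n) m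
stepWeight-coeff-suc false f n m       = 𝕩⊛-coeff-suc (λ n m → + f n m) n m
stepWeight-coeff-suc true  f n zero    = ≡.trans (⊛-assoc 𝕩 𝕥 F (suc n) 0)
  (≡.trans (𝕩⊛-coeff-suc (𝕥 ⊛ F) n 0) (𝕥⊛-coeff-zero F n))
  where F = λ n m → + f n m
stepWeight-coeff-suc true  f n (suc m) = ≡.trans (⊛-assoc 𝕩 𝕥 F (suc n) (suc m))
  (≡.trans (𝕩⊛-coeff-suc (𝕥 ⊛ F) n (suc m)) (𝕥⊛-coeff-suc F n m))
  where F = λ n m → + f n m

endTerm-coeff-zero : ∀ y m → + (if endOk y ∧ (0 ℕ.≡ᵇ m) then 1 else 0) ≡ endTerm y 0 m
endTerm-coeff-zero y m with endOk y
endTerm-coeff-zero y zero    | true = ≡.refl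
endTerm-coeff-zero y (suc m) | true = ≡.refl
endTerm-coeff-zero y m       | false = ≡.refl

endTerm-coeff-suc : ∀ y n m → endTerm y (suc n) m ≡ + 0
endTerm-coeff-suc y n m with endOk y
... | true  = ≡.refl
... | false = ≡.refl

module _ (K : ℕ) (y : ℤ) where

  admissible-outside : inStrip K y ≡ false → ∀ w → admissible K y w ≡ false
  admissible-outside out []      rewrite out = ≡.refl
  admissible-outside out (_ ∷ _) rewrite out = ≡.refl

  admissible-∷ : inStrip K y ≡ true → ∀ s w → admissible K y (s ∷ w) ≡ admissible K (move s y) w
  admissible-∷ inside s w rewrite inside = ≡.refl

  suffixCount-outside : inStrip K y ≡ false → ∀ n p m → suffixCount K n y p m ≡ 0
  suffixCount-outside out n p m =
    count-none (λ w → ≡.cong (_∧ _) (admissible-outside out w)) (paths n)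

  suffixCount-zero : inStrip K y ≡ true → ∀ p m →
    suffixCount K 0 y p m ≡ (if endOk y ∧ (0 ℕ.≡ᵇ m) then 1 else 0)
  suffixCount-zero inside p m =
    ≡.trans (count-singleton (λ w → admissible K y w ∧ (extremalFrom y p w ℕ.≡ᵇ m)) [])
    (≡.cong (λ b → if ((b ∧ true) ∧ endOk y) ∧ (0 ℕ.≡ᵇ m) then 1 else 0) inside)

  suffixCount-suc : inStrip K y ≡ true → ∀ n p m →
    suffixCount K (suc n) y p m
      ≡ shiftIf (extremalAt y p U) (λ m → suffixCount K n (move U y) U m) m
        ℕ.+ shiftIf (extremalAt y p D) (λ m → suffixCount K n (move D y) D m) m
  suffixCount-suc inside n p m =
    ≡.trans (count-++ _ (map (U ∷_) (paths n)) (map (D ∷_) (paths n)))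
            (≡.cong₂ ℕ._+_ (first-step U) (first-step D))
    where
    first-step : ∀ s →
      count (λ w → admissible K y w ∧ (extremalFrom y p w ℕ.≡ᵇ m)) (map (s ∷_) (paths n))
        ≡ shiftIf (extremalAt y p s) (λ m → suffixCount K n (move s y) s m) m
    first-step s = ≡.trans (count-map _ (s ∷_) (paths n))
      (≡.trans (count-cong (λ w → ≡.cong (_∧ _) (admissible-∷ inside s w)) (paths n))
               (count-shiftIf (extremalAt y p s) _ _ (paths n) m))

  G-outside : inStrip K y ≡ false → ∀ p → G K y p ≋ 𝟘
  G-outside out p n m = ≡.cong +_ (suffixCount-outside out n p m)

  G-inside : ∀ {y⁺ y⁻} p → inStrip K y ≡ true → move U y ≡ y⁺ → move D y ≡ y⁻ →
    G K y p ≋ endTerm y ⊕ stepWeight (extremalAt y p U) ⊛ G K y⁺ U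
                         ⊕ stepWeight (extremalAt y p D) ⊛ G K y⁻ D
  G-inside p inside ≡.refl ≡.refl zero m
    rewrite stepWeight-coeff-zero (extremalAt y p U) (G K (move U y) U) m
          | stepWeight-coeff-zero (extremalAt y p D) (G K (move D y) D) m
    = ≡.trans (≡.cong +_ (suffixCount-zero inside p m))
        (≡.trans (endTerm-coeff-zero y m) (≡.sym (≡.trans (ℤP.+-identityʳ _) (ℤP.+-identityʳ _))))
  G-inside p inside ≡.refl ≡.refl (suc n) m
    rewrite endTerm-coeff-suc y n m
          | stepWeight-coeff-suc (extremalAt y p U) (λ n m → suffixCount K n (move U y) U m) n m
          | stepWeight-coeff-suc (extremalAt y p D) (λ n m → suffixCount K n (move D y) D m) n m
    = ≡.cong +_ (suffixCount-suc inside n p m)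

half-double : ∀ n → 2 ℕ.* n ℕ./ 2 ≡ n
half-double n = ≡.trans (/-congˡ {o = 2} (ℕP.*-comm 2 n)) (m*n/n≡m n 2)

half-suc-double : ∀ n → suc (2 ℕ.* n) ℕ./ 2 ≡ n
half-suc-double n = ≡.trans (/-congˡ {o = 2} (≡.cong suc (ℕP.*-comm 2 n)))
  (≡.trans (+-distrib-/ 1 (n ℕ.* 2) no-carry) (m*n/n≡m n 2))
  where
  no-carry : 1 ℕ.+ (n ℕ.* 2) ℕ.% 2 ℕ.< 2
  no-carry = ≡.subst (λ r → 1 ℕ.+ r ℕ.< 2) (≡.sym (m*n%n≡0 n 2)) ℕP.≤-refl

≤ᵇ-true : ∀ {m n} → m ℕ.≤ n → (m ℕ.≤ᵇ n) ≡ true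
≤ᵇ-true m≤n = det (ℕP.≤ᵇ-reflects-≤ _ _) (ofʸ m≤n)

≤ᵇ-false : ∀ {m n} → n ℕ.< m → (m ℕ.≤ᵇ n) ≡ false
≤ᵇ-false n<m = det (ℕP.≤ᵇ-reflects-≤ _ _) (ofⁿ (ℕP.<⇒≱ n<m))

module Strip (k : ℕ) where

  K : ℕ
  K = 2 ℕ.* suc k

  inStrip-K : ∀ y → inStrip K y ≡ (-[1+ k ] ℤ.≤ᵇ y) ∧ (y ℤ.≤ᵇ + suc k)
  inStrip-K y = ≡.cong₂ (λ l u → (l ℤ.≤ᵇ y) ∧ (y ℤ.≤ᵇ u))
    (≡.cong (λ n → ℤ.- (+ n)) (half-suc-double (suc k))) (≡.cong +_ (half-double (suc k)))

  inside-above : ∀ {i} → i ℕ.≤ k → inStrip K (+ suc i) ≡ true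
  inside-above i≤k = ≡.trans (inStrip-K _) (≤ᵇ-true (s≤s i≤k))

  inside-below : ∀ {i} → i ℕ.≤ k → inStrip K -[1+ i ] ≡ true
  inside-below i≤k = ≡.trans (inStrip-K _) (≡.trans (∧-identityʳ _) (≤ᵇ-true i≤k))

  outside-above : inStrip K (+ suc (suc k)) ≡ false
  outside-above = ≡.trans (inStrip-K _) (≤ᵇ-false (ℕP.n<1+n (suc k)))

  outside-below : inStrip K -[1+ suc k ] ≡ false
  outside-below = ≡.trans (inStrip-K _) (≡.cong (_∧ true) (≤ᵇ-false (ℕP.n<1+n k)))

  move-U-+ : ∀ n → move U (+ n) ≡ + suc n
  move-U-+ n = ≡.cong +_ (ℕP.+-comm n 1)

  move-D-neg : ∀ n → move D -[1+ n ] ≡ -[1+ suc n ]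
  move-D-neg n = ≡.cong (λ i → -[1+ suc i ]) (ℕP.+-identityʳ n)

  drop-𝟘 : ∀ a b → 𝟘 ⊕ a ⊕ b ≋ a ⊕ b
  drop-𝟘 a b = S.+-congʳ (S.+-identityˡ a)

  drop-𝟘-swap : ∀ a b → 𝟘 ⊕ a ⊕ b ≋ b ⊕ a
  drop-𝟘-swap a b = S.trans (drop-𝟘 a b) (S.+-comm a b)

  G₀ H u w : PS
  G₀ = G K (+ 0) U
  H  = G K -[1+ 0 ] D
  u  = G K (+ 1) U
  w  = G K -[1+ 1 ] D

  inside-origin : inStrip K (+ 0) ≡ true
  inside-origin = inStrip-K (+ 0)

  eq-G₀ : G₀ ≋ 𝟙 ⊕ 𝕩 ⊛ u ⊕ 𝕩 ⊛ H
  eq-G₀ = G-inside K (+ 0) U inside-origin ≡.refl ≡.refl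

  eq-H : H ≋ 𝟙 ⊕ 𝕩 ⊛ G₀ ⊕ 𝕩 ⊛ w
  eq-H = G-inside K -[1+ 0 ] D (inside-below z≤n) ≡.refl ≡.refl

  G₀-D : G K (+ 0) D ≋ G₀
  G₀-D = S.trans (G-inside K (+ 0) D inside-origin ≡.refl ≡.refl) (S.sym eq-G₀)

  H-U : G K -[1+ 0 ] U ≋ H
  H-U = S.trans (G-inside K -[1+ 0 ] U (inside-below z≤n) ≡.refl ≡.refl) (S.sym eq-H)

  level-above-U : ∀ {i} → i ℕ.< suc k →
    G K (+ suc i) U ≋ 𝕩 ⊛ G K (+ suc (suc i)) U ⊕ 𝕩 ⊛ 𝕥 ⊛ G K (+ i) D
  level-above-U {i} i<L = S.trans
    (G-inside K (+ suc i) U (inside-above (ℕP.≤-pred i<L)) (move-U-+ (suc i)) ≡.refl)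
    (drop-𝟘 (𝕩 ⊛ G K (+ suc (suc i)) U) (𝕩 ⊛ 𝕥 ⊛ G K (+ i) D))

  level-above-D : ∀ {i} → i ℕ.< suc k →
    G K (+ suc i) D ≋ 𝕩 ⊛ G K (+ suc (suc i)) U ⊕ 𝕩 ⊛ G K (+ i) D
  level-above-D {i} i<L = S.trans
    (G-inside K (+ suc i) D (inside-above (ℕP.≤-pred i<L)) (move-U-+ (suc i)) ≡.refl)
    (drop-𝟘 (𝕩 ⊛ G K (+ suc (suc i)) U) (𝕩 ⊛ G K (+ i) D))

  level-below-D : ∀ {i} → i ℕ.< k →
    G K -[1+ suc i ] D ≋ 𝕩 ⊛ G K -[1+ suc (suc i) ] D ⊕ 𝕩 ⊛ 𝕥 ⊛ G K -[1+ i ] U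
  level-below-D {i} i<L = S.trans
    (G-inside K -[1+ suc i ] D (inside-below i<L) ≡.refl (move-D-neg (suc i)))
    (drop-𝟘-swap (𝕩 ⊛ 𝕥 ⊛ G K -[1+ i ] U) (𝕩 ⊛ G K -[1+ suc (suc i) ] D))

  level-below-U : ∀ {i} → i ℕ.< k →
    G K -[1+ suc i ] U ≋ 𝕩 ⊛ G K -[1+ suc (suc i) ] D ⊕ 𝕩 ⊛ G K -[1+ i ] U
  level-below-U {i} i<L = S.trans
    (G-inside K -[1+ suc i ] U (inside-below i<L) ≡.refl (move-D-neg (suc i)))
    (drop-𝟘-swap (𝕩 ⊛ G K -[1+ i ] U) (𝕩 ⊛ G K -[1+ suc (suc i) ] D))

  ratio-above : Ψ (suc k) ⊛ u ≋ 𝕩 ⊛ 𝕥 ⊛ Φ (suc k) ⊛ G₀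
  ratio-above = S.trans
    (ratio-from-wall (suc k) (λ n → G K (+ n) U) (λ n → G K (+ n) D)
      (G-outside K (+ suc (suc k)) outside-above U) level-above-U level-above-D)
    (S.*-congˡ {𝕩 ⊛ 𝕥 ⊛ Φ (suc k)} G₀-D)

  ratio-below : Ψ k ⊛ w ≋ 𝕩 ⊛ 𝕥 ⊛ Φ k ⊛ H
  ratio-below = S.trans
    (ratio-from-wall k (λ n → G K -[1+ n ] D) (λ n → G K -[1+ n ] U)
      (G-outside K -[1+ suc k ] outside-below D) level-below-D level-below-U)
    (S.*-congˡ {𝕩 ⊛ 𝕥 ⊛ Φ k} H-U)

  G₀-times-denominator : G₀ ⊛ (Ψ (suc k) ⊝ 𝕥 ⊛ x² ⊛ Φ (suc k) ⊝ x² ⊛ Ψ k) ≋ Ψ (suc k) ⊕ 𝕩 ⊛ Ψ k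
  G₀-times-denominator =
    eliminate-end-levels (Ψ k) (Ψ (suc k)) (Φ (suc k)) {G₀} {H} {u} eq-G₀ ratio-above
      (end-level-ratio k {G₀} {H} {w} eq-H ratio-below)

  genA≋G₀ : genA K ≋ G₀
  genA≋G₀ n m = ≡.cong +_ (aCoeff≡suffixCount n K m)

theorem2 : (k : ℕ) → 1 ≤ k → (n m : ℕ) →
    (genA (2 ℕ.* k) ⊛ (Λ k ⊝ x² ⊛ Λ (k ∸ 1))) n m
    ≡ ((𝟙 ⊕ 𝕩) ⊛ Φ k ⊝ x² ⊛ (𝟙 ⊕ (𝟙 ⊝ 𝕥) ⊛ 𝕩) ⊛ Φ (k ∸ 1)) n m
theorem2 (suc k) _ = begin
  genA (2 ℕ.* suc k) ⊛ (Λ (suc k) ⊝ x² ⊛ Λ k)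
    ≈⟨ S.*-cong genA≋G₀ (Λ-denominator k) ⟩
  G₀ ⊛ (Ψ (suc k) ⊝ 𝕥 ⊛ x² ⊛ Φ (suc k) ⊝ x² ⊛ Ψ k)
    ≈⟨ G₀-times-denominator ⟩
  Ψ (suc k) ⊕ 𝕩 ⊛ Ψ k
    ≈⟨ numerator-via-Ψ k ⟨
  (𝟙 ⊕ 𝕩) ⊛ Φ (suc k) ⊝ x² ⊛ (𝟙 ⊕ (𝟙 ⊝ 𝕥) ⊛ 𝕩) ⊛ Φ k ∎
  where open Strip k
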